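{- The category $\mathsf{PE}_{\mathbf{Set}}$ is enriched over large sup-monoids.
   Context: $\mathbf{Set}$ is the category of sets and functions. A polynomial over a set $I$ is a diagram of functions $I\xleftarrow{n}D\xrightarrow{d}A\xrightarrow{a}I$. A simulation from $P_1=(I_1\xleftarrow{n_1}D_1\xrightarrow{d_1}A_1\xrightarrow{a_1}I_1)$ to $P_2=(I_2\xleftarrow{n_2}D_2\xrightarrow{d_2}A_2\xrightarrow{a_2}I_2)$ consists of: a span $I_1\xleftarrow{r_1}R\xrightarrow{r_2}I_2$; writing $R\cdot A_1$ for the pullback of $a_1$ along $r_1$ (projections $x$ to $R$, $y$ to $A_1$), a function $\alpha:R\cdot A_1\to A_2$ with $a_2\alpha=r_2x$; writing $R\cdot D_2$ for the pullback of $d_2$ along $\alpha$ (projections $p$, $q$ to $R\cdot A_1$, $D_2$), functions $\beta:R\cdot D_2\to D_1$, $\gamma:R\cdot D_2\to R$ with $d_1\beta=yp$, $n_1\beta=r_1\gamma$, $n_2q=r_2\gamma$. Simulations are identified when there is an isomorphism of spans transporting $\alpha,\beta,\gamma$. Composition: span $R\times_{I_2}R'$, $\alpha''(r,r',a_1)=\alpha'(r',\alpha(r,a_1))$, and for $d_3$ over $\alpha''$, with $d_2=\beta'(r',\alpha(r,a_1),d_3)$, $\beta''=\beta(r,a_1,d_2)$, $\gamma''=(\gamma(r,a_1,d_2),\gamma'(r',\alpha(r,a_1),d_3))$; identities have span $I\xleftarrow{1}I\xrightarrow{1}I$, $\alpha=1$, $\beta=1$, $\gamma=n$. $\mathsf{PE}_{\mathbf{Set}}$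 has polynomials as objects and equivalence classes of simulations as morphisms. A (large) sup-monoid is a (large) commutative monoid with arbitrary set-indexed sums; here the sum of a family of simulations is their colimit (disjoint union of all the data), the neutral element being the empty simulation (all sets empty), and enrichment means composition preserves these sums in each argument. -}

module Defs where

open import Data.Product using (Σ; _,_; proj₁; proj₂; _×_)
open import Data.Unit using (⊤; tt)
open import Relation.Binary.PropositionalEquality using (_≡_; refl; sym; trans)
open import Function.Bundles using (_↔_; Inverse)

record Poly : Set₁ where
  field
    I D A : Set
    n : D → I
    d : D → A
    a : A → I

open Poly

PbA : (P : Poly) {R : Set} → (R → I P) → Set
PbA P {R} r₁ = Σ R λ r → Σ (A P) λ x → a P x ≡ r₁ r

PbD : (Q : Poly) {X : Set} → (X → A Q) → Set
PbD Q {X} α = Σ X λ z → Σ (D Q) λ e → d Q e ≡ α z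

record Sim (P Q : Poly) : Set₁ where
  field
    R  : Set
    r₁ : R → I P
    r₂ : R → I Q
    α  : PbA P r₁ → A Q
    α-eq : ∀ z → a Q (α z) ≡ r₂ (proj₁ z)
    β  : PbD Q α → D P
    γ  : PbD Q α → R
    β-d : ∀ w → d P (β w) ≡ proj₁ (proj₂ (proj₁ w))
    β-n : ∀ w → n P (β w) ≡ r₁ (γ w)
    γ-n : ∀ w → n Q (proj₁ (proj₂ w)) ≡ r₂ (γ w)

open Sim

mapA : ∀ {P Q} (f g : Sim P Q) (φ : R f → R g) →
       (∀ r → r₁ g (φ r) ≡ r₁ f r) → PbA P (r₁ f) → PbA P (r₁ g)
mapA f g φ c₁ (r , x , e) = φ r , x , trans e (sym (c₁ r))

mapD : ∀ {P Q} (f g : Sim P Q) (mA : PbA P (r₁ f) → PbA P (r₁ g)) →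
       (∀ z → α g (mA z) ≡ α f z) → PbD Q (α f) → PbD Q (α g)
mapD f g mA αc (z , e , h) = mA z , e , trans h (sym (αc z))

record _≈S_ {P Q : Poly} (f g : Sim P Q) : Set where
  field
    φ   : R f ↔ R g
    c₁  : ∀ r → r₁ g (Inverse.to φ r) ≡ r₁ f r
    c₂  : ∀ r → r₂ g (Inverse.to φ r) ≡ r₂ f r
    α-c : ∀ z → α g (mapA f g (Inverse.to φ) c₁ z) ≡ α f z
    β-c : ∀ w → β g (mapD f g (mapA f g (Inverse.to φ) c₁) α-c w) ≡ β f w
    γ-c : ∀ w → γ g (mapD f g (mapA f g (Inverse.to φ) c₁) α-c w)
                ≡ Inverse.to φ (γ f w)

infix 4 _≈S_

_⨾_ : ∀ {P₁ P₂ P₃} → Sim P₁ P₂ → Sim P₂ P₃ → Sim P₁ P₃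
_⨾_ {P₁} {P₂} {P₃} f g = record
  { R  = Σ (R f × R g) (λ rr → r₂ f (proj₁ rr) ≡ r₁ g (proj₂ rr))
  ; r₁ = λ s → r₁ f (proj₁ (proj₁ s))
  ; r₂ = λ s → r₂ g (proj₂ (proj₁ s))
  ; α  = α″
  ; α-eq = λ z → α-eq g (inner z)
  ; β  = λ w → β f (wf w)
  ; γ  = λ w → (γ f (wf w) , γ g (wg w)) ,
               trans (sym (γ-n f (wf w))) (β-n g (wg w))
  ; β-d = λ w → β-d f (wf w)
  ; β-n = λ w → β-n f (wf w)
  ; γ-n = λ w → γ-n g (wg w)
  }
  where
  zf : PbA P₁ (λ s → r₁ f (proj₁ (proj₁ s))) → PbA P₁ (r₁ f)
  zf (((r , r') , e) , x , h) = r , x , h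
  inner : PbA P₁ (λ s → r₁ f (proj₁ (proj₁ s))) → PbA P₂ (r₁ g)
  inner z@(((r , r') , e) , x , h) = r' , α f (zf z) , trans (α-eq f (zf z)) e
  α″ : PbA P₁ (λ s → r₁ f (proj₁ (proj₁ s))) → A P₃
  α″ z = α g (inner z)
  wg : PbD P₃ α″ → PbD P₃ (α g)
  wg (z , e , k) = inner z , e , k
  wf : PbD P₃ α″ → PbD P₂ (α f)
  wf w@(z , e , k) = zf z , β g (wg w) , β-d g (wg w)

⨁ : ∀ {P Q} {K : Set} → (K → Sim P Q) → Sim P Q
⨁ {P} {Q} {K} f = record
  { R  = Σ K (λ k → R (f k))
  ; r₁ = λ s → r₁ (f (proj₁ s)) (proj₂ s)
  ; r₂ = λ s → r₂ (f (proj₁ s)) (proj₂ s)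
  ; α  = λ z → α (f (k₀ z)) (loc z)
  ; α-eq = λ z → α-eq (f (k₀ z)) (loc z)
  ; β  = λ w → β (f (k₀ (proj₁ w))) (locD w)
  ; γ  = λ w → k₀ (proj₁ w) , γ (f (k₀ (proj₁ w))) (locD w)
  ; β-d = λ w → β-d (f (k₀ (proj₁ w))) (locD w)
  ; β-n = λ w → β-n (f (k₀ (proj₁ w))) (locD w)
  ; γ-n = λ w → γ-n (f (k₀ (proj₁ w))) (locD w)
  }
  where
  k₀ : PbA P (λ (s : Σ K (λ k → R (f k))) → r₁ (f (proj₁ s)) (proj₂ s)) → K
  k₀ ((k , r) , x , h) = k
  loc : (z : PbA P (λ (s : Σ K (λ k → R (f k))) → r₁ (f (proj₁ s)) (proj₂ s)))
        → PbA P (r₁ (f (k₀ z)))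
  loc ((k , r) , x , h) = r , x , h
  locD : (w : PbD Q (λ z → α (f (k₀ z)) (loc z))) → PbD Q (α (f (k₀ (proj₁ w))))
  locD (z , e , h) = loc z , e , h

-- The empty simulation (neutral element) is the empty sum.
record HomSupMonoid (P Q : Poly) : Set₂ where
  field
    ≈-refl  : ∀ (f : Sim P Q) → f ≈S f
    ≈-sym   : ∀ {f g : Sim P Q} → f ≈S g → g ≈S f
    ≈-trans : ∀ {f g h : Sim P Q} → f ≈S g → g ≈S h → f ≈S h
    ⨁-cong  : ∀ {K : Set} (f g : K → Sim P Q) → (∀ k → f k ≈S g k) → ⨁ f ≈S ⨁ g
    ⨁-unit  : ∀ (f : Sim P Q) → ⨁ {K = ⊤} (λ _ → f) ≈S f
    ⨁-assoc : ∀ (K : Set) (L : K → Set) (f : (k : K) → L k → Sim P Q) →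
              ⨁ {K = Σ K L} (λ kl → f (proj₁ kl) (proj₂ kl)) ≈S ⨁ (λ k → ⨁ (f k))
    ⨁-reindex : ∀ (K K' : Set) (e : K ↔ K') (f : K' → Sim P Q) →
              ⨁ (λ k → f (Inverse.to e k)) ≈S ⨁ f

record EnrichedOverSupMonoids : Set₂ where
  field
    hom : ∀ (P Q : Poly) → HomSupMonoid P Q
    ⨾-cong : ∀ {P₁ P₂ P₃} {f f' : Sim P₁ P₂} {g g' : Sim P₂ P₃} →
             f ≈S f' → g ≈S g' → (f ⨾ g) ≈S (f' ⨾ g')
    ⨾-⨁ˡ : ∀ {P₁ P₂ P₃} {K : Set} (f : K → Sim P₁ P₂) (g : Sim P₂ P₃) →
           (⨁ f ⨾ g) ≈S ⨁ (λ k → f k ⨾ g)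
    ⨾-⨁ʳ : ∀ {P₁ P₂ P₃} {K : Set} (f : Sim P₁ P₂) (g : K → Sim P₂ P₃) →
           (f ⨾ ⨁ g) ≈S ⨁ (λ k → f ⨾ g k)

-- Every law to be checked asserts that two simulations are identified, i.e.
-- that some isomorphism of their spans transports α, β and γ.  In each case
-- the required isomorphism of apexes is a mere repackaging of Σ-types
-- (reassociation, reindexing, pairing of isomorphisms), and the transport
-- conditions then hold because an element of a pullback of sets is determined
-- by its two components: the equality witness is unique (UIP, from axiom K).
module Submission where

open import Defs
open import Data.Product using (Σ; _,_; proj₁; proj₂; _×_)
open import Data.Unit using (⊤; tt)
open import Relation.Binary.PropositionalEquality using (_≡_; refl; sym; trans; cong)
open import Function using (_∘_)
open import Function.Bundles using (_↔_; Inverse; mk↔ₛ′)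
open import Function.Properties.Inverse using (↔-refl; ↔-sym; ↔-trans)
open import Data.Product.Function.Dependent.Propositional using (Σ-↔)
open import Data.Product.Algebra using (Σ-assoc)
open import Axiom.UniquenessOfIdentityProofs.WithK using (uip)

open Poly
open Sim
open Inverse using (to; from; strictlyInverseˡ; strictlyInverseʳ)

-- The pullback of F along G; both R·A₁ (PbA) and R·D₂ (PbD) are of this form.
Pullback : {R A C : Set} → (A → C) → (R → C) → Set
Pullback {R} {A} F G = Σ R λ r → Σ A λ x → F x ≡ G r

pullback-≡ : ∀ {R A C : Set} {F : A → C} {G : R → C} {r r' : R} {x x' : A}
             {e : F x ≡ G r} {e' : F x' ≡ G r'} →
             r ≡ r' → x ≡ x' → _≡_ {A = Pullback F G} (r , x , e) (r' , x' , e')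
pullback-≡ {e = e} {e' = e'} refl refl = cong (λ p → _ , _ , p) (uip e e')

rewitness : ∀ {R A C : Set} {F : A → C} {G : R → C} {r : R} {x : A}
            {e e' : F x ≡ G r} → _≡_ {A = Pullback F G} (r , x , e) (r , x , e')
rewitness = pullback-≡ refl refl

α-irrelevant : ∀ {P Q} (f : Sim P Q) {r : R f} {x : A P} {e e' : a P x ≡ r₁ f r} →
               α f (r , x , e) ≡ α f (r , x , e')
α-irrelevant f = cong (α f) rewitness

rewitness₂ : ∀ {R A C B D : Set} {F : A → C} {G : R → C} {H : B → D}
             {K : Pullback F G → D} {r : R} {x : A} {y : B}
             {e e' : F x ≡ G r} {h : H y ≡ K (r , x , e)} {h' : H y ≡ K (r , x , e')} →
             _≡_ {A = Pullback H K} ((r , x , e) , y , h) ((r , x , e') , y , h')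
rewitness₂ = pullback-≡ rewitness refl

SpanPullback : {A B C : Set} → (A → C) → (B → C) → Set
SpanPullback {A} {B} F G = Σ (A × B) λ ab → F (proj₁ ab) ≡ G (proj₂ ab)

spanPullback-≡ : ∀ {A B C : Set} {F : A → C} {G : B → C} {a a' : A} {b b' : B}
                 {e : F a ≡ G b} {e' : F a' ≡ G b'} → a ≡ a' → b ≡ b' →
                 _≡_ {A = SpanPullback F G} ((a , b) , e) ((a' , b') , e')
spanPullback-≡ {e = e} {e' = e'} refl refl = cong (λ p → _ , p) (uip e e')

spanPullback-↔ : ∀ {A A' B B' C : Set} {F : A → C} {G : B → C} {F' : A' → C} {G' : B' → C}
                 (φ : A ↔ A') (ψ : B ↔ B') →
                 (∀ a → F' (to φ a) ≡ F a) → (∀ b → G' (to ψ b) ≡ G b) →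
                 SpanPullback F G ↔ SpanPullback F' G'
spanPullback-↔ {F = F} {G} {F'} {G'} φ ψ cF cG =
  mk↔ₛ′ forth back
    (λ _ → spanPullback-≡ (strictlyInverseˡ φ _) (strictlyInverseˡ ψ _))
    (λ _ → spanPullback-≡ (strictlyInverseʳ φ _) (strictlyInverseʳ ψ _))
  where
  cF⁻ : ∀ a' → F (from φ a') ≡ F' a'
  cF⁻ a' = trans (sym (cF (from φ a'))) (cong F' (strictlyInverseˡ φ a'))
  cG⁻ : ∀ b' → G (from ψ b') ≡ G' b'
  cG⁻ b' = trans (sym (cG (from ψ b'))) (cong G' (strictlyInverseˡ ψ b'))
  forth : SpanPullback F G → SpanPullback F' G'
  forth ((a , b) , e) = (to φ a , to ψ b) , trans (cF a) (trans e (sym (cG b)))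
  back : SpanPullback F' G' → SpanPullback F G
  back ((a' , b') , e) = (from φ a' , from ψ b') , trans (cF⁻ a') (trans e (sym (cG⁻ b')))

module Transport {P Q : Poly} {f g : Sim P Q} (E : f ≈S g) where
  open _≈S_ E public

  transportA : PbA P (r₁ f) → PbA P (r₁ g)
  transportA = mapA f g (to φ) c₁

  transportD : PbD Q (α f) → PbD Q (α g)
  transportD = mapD f g transportA α-c

module _ {P Q : Poly} where

  ≈S-refl : ∀ (f : Sim P Q) → f ≈S f
  ≈S-refl f = record
    { φ = ↔-refl
    ; c₁ = λ _ → refl
    ; c₂ = λ _ → refl
    ; α-c = λ _ → α-irrelevant f
    ; β-c = λ _ → cong (β f) rewitness₂
    ; γ-c = λ _ → cong (γ f) rewitness₂
    }

  ≈S-sym : ∀ {f g : Sim P Q} → f ≈S g → g ≈S f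
  ≈S-sym {f} {g} E = record
    { φ = ↔-sym φ
    ; c₁ = c₁⁻
    ; c₂ = λ s → trans (sym (c₂ (from φ s))) (cong (r₂ g) (strictlyInverseˡ φ s))
    ; α-c = α-c⁻
    ; β-c = λ w → trans (sym (β-c (back w))) (cong (β g) (round-trip w))
    ; γ-c = λ w → trans (sym (strictlyInverseʳ φ _))
                        (cong (from φ) (trans (sym (γ-c (back w))) (cong (γ g) (round-trip w))))
    }
    where
    open Transport E
    c₁⁻ : ∀ s → r₁ f (from φ s) ≡ r₁ g s
    c₁⁻ s = trans (sym (c₁ (from φ s))) (cong (r₁ g) (strictlyInverseˡ φ s))
    backA : PbA P (r₁ g) → PbA P (r₁ f)
    backA = mapA g f (from φ) c₁⁻
    round-tripA : ∀ z → transportA (backA z) ≡ z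
    round-tripA _ = pullback-≡ (strictlyInverseˡ φ _) refl
    α-c⁻ : ∀ z → α f (backA z) ≡ α g z
    α-c⁻ z = trans (sym (α-c (backA z))) (cong (α g) (round-tripA z))
    back : PbD Q (α g) → PbD Q (α f)
    back = mapD g f backA α-c⁻
    round-trip : ∀ w → transportD (back w) ≡ w
    round-trip _ = pullback-≡ (round-tripA _) refl

  ≈S-trans : ∀ {f g h : Sim P Q} → f ≈S g → g ≈S h → f ≈S h
  ≈S-trans {f} {g} {h} E F = record
    { φ = ↔-trans E.φ F.φ
    ; c₁ = c₁∘
    ; c₂ = λ r → trans (F.c₂ (to E.φ r)) (E.c₂ r)
    ; α-c = α-c∘
    ; β-c = λ w → trans (cong (β h) (two-stepsD w)) (trans (F.β-c _) (E.β-c w))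
    ; γ-c = λ w → trans (cong (γ h) (two-stepsD w)) (trans (F.γ-c _) (cong (to F.φ) (E.γ-c w)))
    }
    where
    module E = Transport E
    module F = Transport F
    c₁∘ : ∀ r → r₁ h (to F.φ (to E.φ r)) ≡ r₁ f r
    c₁∘ r = trans (F.c₁ (to E.φ r)) (E.c₁ r)
    directA : PbA P (r₁ f) → PbA P (r₁ h)
    directA = mapA f h (to F.φ ∘ to E.φ) c₁∘
    two-stepsA : ∀ z → directA z ≡ F.transportA (E.transportA z)
    two-stepsA _ = rewitness
    α-c∘ : ∀ z → α h (directA z) ≡ α f z
    α-c∘ z = trans (cong (α h) (two-stepsA z)) (trans (F.α-c _) (E.α-c z))
    two-stepsD : ∀ w → mapD f h directA α-c∘ w ≡ F.transportD (E.transportD w)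
    two-stepsD _ = pullback-≡ (two-stepsA _) refl

  ⨁-cong : ∀ {K : Set} (f g : K → Sim P Q) → (∀ k → f k ≈S g k) → ⨁ f ≈S ⨁ g
  ⨁-cong f g E = record
    { φ = Σ-↔ ↔-refl (λ {k} → φ k)
    ; c₁ = λ { (k , r) → c₁ k r }
    ; c₂ = λ { (k , r) → c₂ k r }
    ; α-c = λ { ((k , r) , x , e) → α-c k (r , x , e) }
    ; β-c = λ { (((k , _) , _) , _) → trans (cong (β (g k)) rewitness₂) (β-c k _) }
    ; γ-c = λ { (((k , _) , _) , _) →
        cong (k ,_) (trans (cong (γ (g k)) rewitness₂) (γ-c k _)) }
    }
    where
    open module Summand k = _≈S_ (E k)

  ⨁-unit : ∀ (f : Sim P Q) → ⨁ {K = ⊤} (λ _ → f) ≈S f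
  ⨁-unit f = record
    { φ = mk↔ₛ′ proj₂ (tt ,_) (λ _ → refl) (λ _ → refl)
    ; c₁ = λ _ → refl
    ; c₂ = λ _ → refl
    ; α-c = λ _ → α-irrelevant f
    ; β-c = λ _ → cong (β f) rewitness₂
    ; γ-c = λ _ → cong (γ f) rewitness₂
    }

  ⨁-assoc : ∀ (K : Set) (L : K → Set) (f : (k : K) → L k → Sim P Q) →
            ⨁ {K = Σ K L} (λ kl → f (proj₁ kl) (proj₂ kl)) ≈S ⨁ (λ k → ⨁ (f k))
  ⨁-assoc K L f = record
    { φ = Σ-assoc
    ; c₁ = λ _ → refl
    ; c₂ = λ _ → refl
    ; α-c = λ { (((k , l) , _) , _) → α-irrelevant (f k l) }
    ; β-c = λ { ((((k , l) , _) , _) , _) → cong (β (f k l)) rewitness₂ }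
    ; γ-c = λ { ((((k , l) , _) , _) , _) →
        cong (λ q → k , l , q) (cong (γ (f k l)) rewitness₂) }
    }

  ⨁-reindex : ∀ (K K' : Set) (e : K ↔ K') (f : K' → Sim P Q) →
              ⨁ (λ k → f (to e k)) ≈S ⨁ f
  ⨁-reindex K K' e f = record
    { φ = Σ-↔ e ↔-refl
    ; c₁ = λ _ → refl
    ; c₂ = λ _ → refl
    ; α-c = λ { ((k , _) , _) → α-irrelevant (f (to e k)) }
    ; β-c = λ { (((k , _) , _) , _) → cong (β (f (to e k))) rewitness₂ }
    ; γ-c = λ { (((k , _) , _) , _) →
        cong (to e k ,_) (cong (γ (f (to e k))) rewitness₂) }
    }

module Stages {P₁ P₂ P₃ : Poly} (f : Sim P₁ P₂) (g : Sim P₂ P₃) where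

  midPosition : PbA P₁ (r₁ (f ⨾ g)) → PbA P₂ (r₁ g)
  midPosition (((r , r') , e) , x , h) =
    r' , α f (r , x , h) , trans (α-eq f (r , x , h)) e

  secondDirection : PbD P₃ (α (f ⨾ g)) → PbD P₃ (α g)
  secondDirection (z , e₃ , k) = midPosition z , e₃ , k

  firstDirection : PbD P₃ (α (f ⨾ g)) → PbD P₂ (α f)
  firstDirection w@((((r , r') , e) , x , h) , _) =
    (r , x , h) , β g (secondDirection w) , β-d g (secondDirection w)

module CompositionCongruence {P₁ P₂ P₃ : Poly} {f f' : Sim P₁ P₂} {g g' : Sim P₂ P₃}
                             (E : f ≈S f') (F : g ≈S g') where
  private
    module E = Transport E
    module F = Transport F
    open Stages

  apex : R (f ⨾ g) ↔ R (f' ⨾ g')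
  apex = spanPullback-↔ E.φ F.φ E.c₂ F.c₁

  c₁ : ∀ s → r₁ (f' ⨾ g') (to apex s) ≡ r₁ (f ⨾ g) s
  c₁ ((r , _) , _) = E.c₁ r

  c₂ : ∀ s → r₂ (f' ⨾ g') (to apex s) ≡ r₂ (f ⨾ g) s
  c₂ ((_ , r') , _) = F.c₂ r'

  transportA : PbA P₁ (r₁ (f ⨾ g)) → PbA P₁ (r₁ (f' ⨾ g'))
  transportA = mapA (f ⨾ g) (f' ⨾ g') (to apex) c₁

  mid-transport : ∀ z → midPosition f' g' (transportA z) ≡ F.transportA (midPosition f g z)
  mid-transport (((r , _) , _) , x , h) = pullback-≡ refl (E.α-c (r , x , h))

  α-c : ∀ z → α (f' ⨾ g') (transportA z) ≡ α (f ⨾ g) z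
  α-c z = trans (cong (α g') (mid-transport z)) (F.α-c (midPosition f g z))

  transportD : PbD P₃ (α (f ⨾ g)) → PbD P₃ (α (f' ⨾ g'))
  transportD = mapD (f ⨾ g) (f' ⨾ g') transportA α-c

  second-transport : ∀ w → secondDirection f' g' (transportD w)
                           ≡ F.transportD (secondDirection f g w)
  second-transport (z , _) = pullback-≡ (mid-transport z) refl

  first-transport : ∀ w → firstDirection f' g' (transportD w)
                          ≡ E.transportD (firstDirection f g w)
  first-transport w = pullback-≡ rewitness
    (trans (cong (β g') (second-transport w)) (F.β-c (secondDirection f g w)))

  identification : (f ⨾ g) ≈S (f' ⨾ g')
  identification = record
    { φ = apex
    ; c₁ = c₁
    ; c₂ = c₂
    ; α-c = α-c
    ; β-c = λ w → trans (cong (β f') (first-transport w)) (E.β-c (firstDirection f g w))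
    ; γ-c = λ w → spanPullback-≡
        (trans (cong (γ f') (first-transport w)) (E.γ-c (firstDirection f g w)))
        (trans (cong (γ g') (second-transport w)) (F.γ-c (secondDirection f g w)))
    }

-- Composition distributes over sums in its first argument: the apex of
-- (⨁ f) ⨾ g is that of ⨁ (f k ⨾ g) up to reassociation, and the two stages
-- of every position and direction agree up to irrelevant equality witnesses.
⨾-⨁-left : ∀ {P₁ P₂ P₃} {K : Set} (f : K → Sim P₁ P₂) (g : Sim P₂ P₃) →
           (⨁ f ⨾ g) ≈S ⨁ (λ k → f k ⨾ g)
⨾-⨁-left f g = record
  { φ = mk↔ₛ′ (λ { (((k , r) , r') , e) → k , ((r , r') , e) })
              (λ { (k , ((r , r') , e)) → ((k , r) , r') , e })
              (λ _ → refl) (λ _ → refl)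
  ; c₁ = λ _ → refl
  ; c₂ = λ _ → refl
  ; α-c = λ { ((((k , _) , _) , _) , _) → cong (α g) (pullback-≡ refl (α-irrelevant (f k))) }
  ; β-c = λ { (((((k , _) , _) , _) , _) , _) →
      let second = pullback-≡ (pullback-≡ refl (α-irrelevant (f k))) refl
          first  = pullback-≡ rewitness (cong (β g) second)
      in cong (β (f k)) first }
  ; γ-c = λ { (((((k , _) , _) , _) , _) , _) →
      let second = pullback-≡ (pullback-≡ refl (α-irrelevant (f k))) refl
          first  = pullback-≡ rewitness (cong (β g) second)
      in cong (k ,_) (spanPullback-≡ (cong (γ (f k)) first) (cong (γ g) second)) }
  }

⨾-⨁-right : ∀ {P₁ P₂ P₃} {K : Set} (f : Sim P₁ P₂) (g : K → Sim P₂ P₃) →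
            (f ⨾ ⨁ g) ≈S ⨁ (λ k → f ⨾ g k)
⨾-⨁-right f g = record
  { φ = mk↔ₛ′ (λ { ((r , (k , r')) , e) → k , ((r , r') , e) })
              (λ { (k , ((r , r') , e)) → (r , (k , r')) , e })
              (λ _ → refl) (λ _ → refl)
  ; c₁ = λ _ → refl
  ; c₂ = λ _ → refl
  ; α-c = λ { (((_ , (k , _)) , _) , _) → cong (α (g k)) (pullback-≡ refl (α-irrelevant f)) }
  ; β-c = λ { ((((_ , (k , _)) , _) , _) , _) →
      let second = pullback-≡ (pullback-≡ refl (α-irrelevant f)) refl
          first  = pullback-≡ rewitness (cong (β (g k)) second)
      in cong (β f) first }
  ; γ-c = λ { ((((_ , (k , _)) , _) , _) , _) →
      let second = pullback-≡ (pullback-≡ refl (α-irrelevant f)) refl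
          first  = pullback-≡ rewitness (cong (β (g k)) second)
      in cong (k ,_) (spanPullback-≡ (cong (γ f) first) (cong (γ (g k)) second)) }
  }

proposition3p1 : EnrichedOverSupMonoids
proposition3p1 = record
  { hom = λ P Q → record
      { ≈-refl    = ≈S-refl
      ; ≈-sym     = ≈S-sym
      ; ≈-trans   = ≈S-trans
      ; ⨁-cong    = ⨁-cong
      ; ⨁-unit    = ⨁-unit
      ; ⨁-assoc   = ⨁-assoc
      ; ⨁-reindex = ⨁-reindex
      }
  ; ⨾-cong = CompositionCongruence.identification
  ; ⨾-⨁ˡ   = ⨾-⨁-left
  ; ⨾-⨁ʳ   = ⨾-⨁-right
  }
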